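{- Let $\mathcal{G}$ be a maximal ancestral graph (MAG). Then: (i) two vertices $a,b$ are adjacent in $\mathcal{G}$ if and only if $\{a,b\}\in\mathcal{S}(\mathcal{G})$; (ii) for every unshielded triple $(a,b,c)$ in $\mathcal{G}$, $\{a,b,c\}\in\mathcal{S}(\mathcal{G})$ if and only if $b$ is a collider on the path $\langle a,b,c\rangle$; (iii) if $\pi=\langle x,q_1,\dots,q_m,b,y\rangle$ is a discriminating path for $b$ in $\mathcal{G}$, then $\{x,b,y\}\in\mathcal{S}(\mathcal{G})$ if and only if $b$ is a collider on $\pi$.
   Context: An acyclic directed mixed graph (ADMG) $\mathcal{G}$ on a finite vertex set $\mathcal{V}$ has directed ($a\to b$) and bidirected ($a\leftrightarrow b$) edges and no directed cycle. $\mathrm{pa}_{\mathcal{G}}(v)=\{w:w\to v\}$, $\mathrm{sib}_{\mathcal{G}}(v)=\{w:w\leftrightarrow v\}$, $\mathrm{an}_{\mathcal{G}}(v)$ ($\mathrm{de}_{\mathcal{G}}(v)$) is $v$ together with vertices having a directed path to (from) $v$, $\mathrm{dis}_{\mathcal{G}}(v)$ is $v$ together with vertices joined to $v$ by a path of bidirected edges; for sets take unions. $\mathcal{G}_W$ is the induced subgraph on $W$, $\mathrm{dis}_W(\cdot)$ the district in $\mathcal{G}_W$. A path is a sequence of distinct vertices, consecutive ones joined by an edge; a non-endpoint $w$ is a collider if both path edges at $w$ have an arrowhead at $w$ (each is $\to w$ or $\leftrightarrow w$), else a noncollider. For $a,b\notin C$, a path between $a,b$ is m-connecting given $C$ if all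 noncolliders are outside $C$ and all colliders are in $\mathrm{an}_{\mathcal{G}}(C)$; $a,b$ are m-separated by $C$ if no such path exists. Vertices are adjacent if joined by an edge. $\mathcal{G}$ is maximal if each nonadjacent pair is m-separated by some set, ancestral if $\mathrm{sib}_{\mathcal{G}}(v)\cap\mathrm{an}_{\mathcal{G}}(v)=\emptyset$ for all $v$; a MAG is a maximal ancestral ADMG. An unshielded triple $(a,b,c)$ consists of vertices with $a,b$ adjacent, $b,c$ adjacent, and $a,c$ nonadjacent. A discriminating path for $b$ is a path $\pi=\langle x,q_1,\dots,q_m,b,y\rangle$, $m\ge1$, with $x,y$ nonadjacent, such that: the edge between $x$ and $q_1$ has an arrowhead at $q_1$; $q_i\leftrightarrow q_{i+1}$ for $1\le i<m$; $q_i\to y$ for every $1\le i\le m$; the edge between $q_m$ and $b$ has an arrowhead at $q_m$; and the edge between $b$ and $y$ has an arrowhead at $y$. $\mathrm{barren}_{\mathcal{G}}(W)=\{w\in W:\mathrm{de}_{\mathcal{G}}(w)\cap W=\{w\}\}$. A head is $H\subseteq\mathcal{V}$ with $\mathrm{barren}_{\mathcal{G}}(H)=H$ and $H$ contained in one district of $\mathcal{G}_{\mathrm{an}_{\mathcal{G}}(H)}$; $\mathrm{tail}(H)=(\mathrm{dis}_{\mathrm{an}(H)}(H)\setminus H)\cup\mathrm{pa}_{\mathcal{G}}(\mathrm{dis}_{\mathrm{an}(H)}(H))$. $\mathcal{S}(\mathcal{G})=\{H\cup A:H\text{ a head},\ A\subseteq\mathrm{tail}(H)\}$. -}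

module Defs where

open import Data.Nat using (ℕ)
open import Data.Bool using (Bool; true; false)
open import Data.Fin using (Fin)
open import Data.Fin.Subset using (Subset; _∈_; _∉_; _∪_; ⁅_⁆)
open import Data.List using (List; []; _∷_; _++_)
open import Data.List.Relation.Unary.All using (All)
open import Data.List.Relation.Unary.Unique.Propositional using (Unique)
open import Data.Product using (Σ; ∃; _×_; _,_)
open import Data.Sum using (_⊎_)
open import Relation.Binary.PropositionalEquality using (_≡_; _≢_)
open import Relation.Nullary using (¬_)
open import Data.Empty using (⊥)

pairs : {A : Set} → List A → List (A × A)
pairs (x ∷ y ∷ r) = (x , y) ∷ pairs (y ∷ r)
pairs _ = []

triples : {A : Set} → List A → List (A × A × A)
triples (x ∷ y ∷ z ∷ r) = (x , y , z) ∷ triples (y ∷ z ∷ r)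
triples _ = []

last' : {A : Set} → A → List A → A
last' q [] = q
last' q (r ∷ rs) = last' r rs

-- a → b  iff  dir a b ≡ true ;  a ↔ b  iff  bi a b ≡ true
record DMG (n : ℕ) : Set where
  field
    dir    : Fin n → Fin n → Bool
    bi     : Fin n → Fin n → Bool
    bi-sym : ∀ a b → bi a b ≡ bi b a

module _ {n : ℕ} (G : DMG n) where
  open DMG G

  V : Set
  V = Fin n

  -- Anc a b :  a ∈ an(b)  (a = b, or a directed path a → ... → b)
  data Anc : V → V → Set where
    anc-refl : ∀ {a} → Anc a a
    anc-step : ∀ {a c b} → dir a c ≡ true → Anc c b → Anc a b

  Acyclic : Set
  Acyclic = ∀ a b → dir a b ≡ true → Anc b a → ⊥

  Adj : V → V → Set
  Adj a b = (dir a b ≡ true) ⊎ (dir b a ≡ true) ⊎ (bi a b ≡ true)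

  Arr : V → V → Set
  Arr u w = (dir u w ≡ true) ⊎ (bi u w ≡ true)

  Collider : V → V → V → Set
  Collider u w v = Arr u w × Arr v w

  IsPath : List V → Set
  IsPath vs = Unique vs × All (λ { (u , v) → Adj u v }) (pairs vs)

  AnOf : Subset n → V → Set
  AnOf C w = ∃ λ c → c ∈ C × Anc w c

  MOk : Subset n → V × V × V → Set
  MOk C (u , w , v) = (Collider u w v → AnOf C w) × (¬ Collider u w v → w ∉ C)

  MConnected : Subset n → V → V → Set
  MConnected C a b = Σ (List V) λ ms →
    let π = a ∷ ms ++ b ∷ [] in IsPath π × All (MOk C) (triples π)

  MSeparated : Subset n → V → V → Set
  MSeparated C a b = a ∉ C × b ∉ C × ¬ MConnected C a b

  Maximal : Set
  Maximal = ∀ a b → a ≢ b → ¬ Adj a b → ∃ λ C → MSeparated C a b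

  Ancestral : Set
  Ancestral = ∀ v w → bi w v ≡ true → ¬ Anc w v

  IsMAG : Set
  IsMAG = Acyclic × Ancestral × Maximal

  InAn : Subset n → V → Set
  InAn H w = ∃ λ h → h ∈ H × Anc w h

  -- BiConn W u v :  u , v in the same district of the induced subgraph G_W
  data BiConn (W : V → Set) : V → V → Set where
    bc-refl : ∀ {u} → W u → BiConn W u u
    bc-step : ∀ {u w v} → W u → bi u w ≡ true → BiConn W w v → BiConn W u v

  BarrenAll : Subset n → Set
  BarrenAll H = ∀ h w → h ∈ H → w ∈ H → Anc h w → h ≡ w

  IsHead : Subset n → Set
  IsHead H = BarrenAll H × (∀ h h' → h ∈ H → h' ∈ H → BiConn (InAn H) h h')

  InDisAn : Subset n → V → Set
  InDisAn H v = ∃ λ h → h ∈ H × BiConn (InAn H) h v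

  InTail : Subset n → V → Set
  InTail H v = (InDisAn H v × v ∉ H) ⊎ (∃ λ d → InDisAn H d × dir v d ≡ true)

  InS : Subset n → Set
  InS X = Σ (Subset n) λ H → Σ (Subset n) λ A →
    IsHead H × (∀ v → v ∈ A → InTail H v) × (H ∪ A ≡ X)

  Unshielded : V → V → V → Set
  Unshielded a b c = Adj a b × Adj b c × ¬ Adj a c × a ≢ c

  -- ⟨ x , q₁ , … , q_m , b , y ⟩ with q₁ ∷ qr = q₁ … q_m is a discriminating path for b
  Discriminating : V → V → List V → V → V → Set
  Discriminating x q₁ qr b y =
    IsPath (x ∷ q₁ ∷ qr ++ b ∷ y ∷ [])
    × ¬ Adj x y
    × Arr x q₁
    × All (λ { (u , v) → bi u v ≡ true }) (pairs (q₁ ∷ qr))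
    × All (λ q → dir q y ≡ true) (q₁ ∷ qr)
    × Arr b (last' q₁ qr)
    × Arr b y

module Submission where

-- Every "if" direction is a construction: a head H (a singleton, a bidirected pair,
-- or pairwise incomparable vertices bidirectedly joined to a hub) and tail vertices A
-- with H ∪ A the required set.  The "only if" directions rest on two facts.
--  * District lemma: if u ≢ v are joined by a bidirected path through ancestors of u
--    or v, they are m-connected given every C, hence adjacent by maximality.  The
--    m-connecting path is built by walking the bidirected path back from v, replacing
--    a vertex outside an(C) by its directed path down to u or v, and shortcutting.
--  * Out-edge lemma: if b → c and a, c are not adjacent, then {a, b, c} ∉ 𝒮(G):
--    b in the head contradicts barrenness or acyclicity; otherwise the head lies in
--    {a, c} and a, c would be adjacent.  A noncollider b has such an out-edge.

open import Defs
open import Data.Nat using (ℕ; zero; suc; _≤_; s≤s)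
open import Data.Nat.Properties using (≤-trans; n≤1+n)
open import Data.Bool using (true)
import Data.Bool as Bool
open import Data.Fin using (Fin; zero; suc; _≟_)
open import Data.Fin.Properties using (any?; injective⇒≤)
open import Data.Fin.Subset using (Subset; _∪_; ⁅_⁆; _∈_; _∉_) renaming (⊥ to ∅)
open import Data.Fin.Subset.Properties
  using (_∈?_; x∈p∪q⁻; x∈p∪q⁺; x∈⁅x⁆; x∈⁅y⁆⇒x≡y; ∉⊥; ∪-assoc; ∪-comm; ∪-identityʳ)
open import Data.List using (List; []; _∷_; _++_; length; lookup)
open import Data.List.Membership.Propositional using () renaming (_∈_ to _∈ₗ_)
open import Data.List.Membership.Propositional.Properties using (∈-lookup; ∈-++⁺ˡ; ∈-++⁺ʳ; ∈-++⁻)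
import Data.List.Membership.DecPropositional as DecMembership
open import Data.List.Relation.Unary.All as All using (All; []; _∷_)
open import Data.List.Relation.Unary.All.Properties using (¬Any⇒All¬)
open import Data.List.Relation.Unary.AllPairs using (AllPairs; []; _∷_)
open import Data.List.Relation.Unary.Any using (here; there)
open import Data.List.Relation.Unary.Unique.Propositional using (Unique)
open import Data.Product using (∃; _×_; _,_; proj₁; proj₂)
open import Data.Sum using (_⊎_; inj₁; inj₂; [_,_])
open import Data.Empty using (⊥; ⊥-elim)
open import Data.Unit using (⊤; tt)
open import Function using (_∘_)
open import Function.Bundles using (_⇔_; mk⇔)
open import Relation.Binary.PropositionalEquality using (_≡_; _≢_; refl; sym; trans; cong; subst; module ≡-Reasoning)
open import Relation.Nullary using (¬_; Dec; yes; no)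
open import Relation.Nullary.Decidable using (_×-dec_; _⊎-dec_; map′)

module ListFacts {A : Set} where

  data EndsAt (v : A) : List A → Set where
    end  : EndsAt v (v ∷ [])
    cons : ∀ {x xs} → EndsAt v xs → EndsAt v (x ∷ xs)

  data Suffix : List A → List A → Set where
    whole : ∀ {xs} → Suffix xs xs
    drop  : ∀ {x ys xs} → Suffix ys xs → Suffix ys (x ∷ xs)

  suffix-at : ∀ {y xs} → y ∈ₗ xs → ∃ λ t → Suffix (y ∷ t) xs
  suffix-at (here refl) = _ , whole
  suffix-at (there y∈) with suffix-at y∈
  ... | t , s = t , drop s

  suffix-unique : ∀ {ys xs} → Suffix ys xs → Unique xs → Unique ys
  suffix-unique whole u = u
  suffix-unique (drop s) (_ ∷ u) = suffix-unique s u

  suffix-pairs : ∀ {P : A × A → Set} {ys xs} → Suffix ys xs → All P (pairs xs) → All P (pairs ys)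
  suffix-pairs whole ps = ps
  suffix-pairs (drop {xs = []} s) ps = suffix-pairs s []
  suffix-pairs (drop {xs = _ ∷ _} s) (_ ∷ ps) = suffix-pairs s ps

  suffix-triples : ∀ {P : A × A × A → Set} {ys xs} →
                   Suffix ys xs → All P (triples xs) → All P (triples ys)
  suffix-triples whole ps = ps
  suffix-triples (drop {xs = []} s) ps = suffix-triples s []
  suffix-triples (drop {xs = _ ∷ []} s) ps = suffix-triples s []
  suffix-triples (drop {xs = _ ∷ _ ∷ _} s) (_ ∷ ps) = suffix-triples s ps

  suffix-ends : ∀ {v y t xs} → Suffix (y ∷ t) xs → EndsAt v xs → EndsAt v (y ∷ t)
  suffix-ends whole e = e
  suffix-ends (drop {xs = _ ∷ _} s) (cons e) = suffix-ends s e

  ends-split : ∀ {v xs} → EndsAt v xs → ∃ λ ms → xs ≡ ms ++ v ∷ []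
  ends-split end = [] , refl
  ends-split (cons {x} e) with ends-split e
  ... | ms , eq = x ∷ ms , cong (x ∷_) eq

  ends-split-tail : ∀ {u v t} → u ≢ v → EndsAt v (u ∷ t) → ∃ λ ms → t ≡ ms ++ v ∷ []
  ends-split-tail u≢v end = ⊥-elim (u≢v refl)
  ends-split-tail _ (cons e) = ends-split e

  lookup-injective : ∀ {xs : List A} → Unique xs → ∀ {i j} → lookup xs i ≡ lookup xs j → i ≡ j
  lookup-injective {xs = _ ∷ _} (_ ∷ _) {zero} {zero} _ = refl
  lookup-injective {xs = _ ∷ _} (x∉ ∷ _) {zero} {suc j} eq = ⊥-elim (All.lookup x∉ (∈-lookup j) eq)
  lookup-injective {xs = _ ∷ _} (x∉ ∷ _) {suc i} {zero} eq = ⊥-elim (All.lookup x∉ (∈-lookup i) (sym eq))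
  lookup-injective {xs = _ ∷ _} (_ ∷ u) {suc i} {suc j} eq = cong suc (lookup-injective u eq)

  last'-member : ∀ (q : A) qs → last' q qs ∈ₗ (q ∷ qs)
  last'-member q [] = here refl
  last'-member q (r ∷ rs) = there (last'-member r rs)

  allPairs-members : ∀ {R : A → A → Set} {xs x y} →
                     AllPairs R xs → x ∈ₗ xs → y ∈ₗ xs → x ≡ y ⊎ R x y ⊎ R y x
  allPairs-members (_ ∷ _) (here refl) (here refl) = inj₁ refl
  allPairs-members (r ∷ _) (here refl) (there y∈) = inj₂ (inj₁ (All.lookup r y∈))
  allPairs-members (r ∷ _) (there x∈) (here refl) = inj₂ (inj₂ (All.lookup r x∈))
  allPairs-members (_ ∷ rs) (there x∈) (there y∈) = allPairs-members rs x∈ y∈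

open ListFacts

unique-length : ∀ {n} {xs : List (Fin n)} → Unique xs → length xs ≤ n
unique-length u = injective⇒≤ (lookup-injective u)

module GraphFacts {n : ℕ} (G : DMG n) where
  open DMG G

  bi-flip : ∀ {a b} → bi a b ≡ true → bi b a ≡ true
  bi-flip {a} {b} e = trans (bi-sym b a) e

  anc-edge : ∀ {a b} → dir a b ≡ true → Anc G a b
  anc-edge d = anc-step d anc-refl

  adj-sym : ∀ {a b} → Adj G a b → Adj G b a
  adj-sym (inj₁ d) = inj₂ (inj₁ d)
  adj-sym (inj₂ (inj₁ d)) = inj₁ d
  adj-sym (inj₂ (inj₂ e)) = inj₂ (inj₂ (bi-flip e))

  arr⇒adj : ∀ {a b} → Arr G a b → Adj G a b
  arr⇒adj (inj₁ d) = inj₁ d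
  arr⇒adj (inj₂ e) = inj₂ (inj₂ e)

  dir-without-arrow : ∀ {a b} → Adj G a b → ¬ Arr G a b → dir b a ≡ true
  dir-without-arrow (inj₁ d) no-arrow = ⊥-elim (no-arrow (inj₁ d))
  dir-without-arrow (inj₂ (inj₁ d)) _ = d
  dir-without-arrow (inj₂ (inj₂ e)) no-arrow = ⊥-elim (no-arrow (inj₂ e))

  adj? : ∀ a b → Dec (Adj G a b)
  adj? a b = (dir a b Bool.≟ true) ⊎-dec ((dir b a Bool.≟ true) ⊎-dec (bi a b Bool.≟ true))

  arr? : ∀ a b → Dec (Arr G a b)
  arr? a b = (dir a b Bool.≟ true) ⊎-dec (bi a b Bool.≟ true)

  biconn-start : ∀ {W a b} → BiConn G W a b → W a
  biconn-start (bc-refl w) = w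
  biconn-start (bc-step w _ _) = w

  biconn-end : ∀ {W a b} → BiConn G W a b → W b
  biconn-end (bc-refl w) = w
  biconn-end (bc-step _ _ p) = biconn-end p

  biconn-edge : ∀ {W a b} → W a → W b → bi a b ≡ true → BiConn G W a b
  biconn-edge wa wb e = bc-step wa e (bc-refl wb)

  biconn-snoc : ∀ {W a b c} → BiConn G W a b → bi b c ≡ true → W c → BiConn G W a c
  biconn-snoc (bc-refl w) e wc = biconn-edge w wc e
  biconn-snoc (bc-step w e' p) e wc = bc-step w e' (biconn-snoc p e wc)

  biconn-sym : ∀ {W a b} → BiConn G W a b → BiConn G W b a
  biconn-sym (bc-refl w) = bc-refl w
  biconn-sym (bc-step w e p) = biconn-snoc (biconn-sym p) (bi-flip e) w

  biconn-trans : ∀ {W a b c} → BiConn G W a b → BiConn G W b c → BiConn G W a c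
  biconn-trans (bc-refl _) q = q
  biconn-trans (bc-step w e p) q = bc-step w e (biconn-trans p q)

  biconn-chain : ∀ {W} q qs → All (λ { (u , w) → bi u w ≡ true }) (pairs (q ∷ qs)) →
                 (∀ {z} → z ∈ₗ (q ∷ qs) → W z) → BiConn G W q (last' q qs)
  biconn-chain q [] _ inW = bc-refl (inW (here refl))
  biconn-chain q (r ∷ rs) (e ∷ es) inW = bc-step (inW (here refl)) e (biconn-chain r rs es (inW ∘ there))

-- In an acyclic graph on Fin n, directed paths visit distinct vertices, so have fewer
-- than n steps; ancestry is therefore decidable.
module Ancestry {n : ℕ} (G : DMG n) (acyclic : Acyclic G) where
  open DMG G

  Reach : ℕ → Fin n → Fin n → Set
  Reach zero a b = a ≡ b
  Reach (suc k) a b = a ≡ b ⊎ ∃ λ c → dir a c ≡ true × Reach k c b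

  reach? : ∀ k a b → Dec (Reach k a b)
  reach? zero a b = a ≟ b
  reach? (suc k) a b = (a ≟ b) ⊎-dec any? (λ c → (dir a c Bool.≟ true) ×-dec reach? k c b)

  reach⇒anc : ∀ k {a b} → Reach k a b → Anc G a b
  reach⇒anc zero refl = anc-refl
  reach⇒anc (suc k) (inj₁ refl) = anc-refl
  reach⇒anc (suc k) (inj₂ (c , d , r)) = anc-step d (reach⇒anc k r)

  later : ∀ {a b} → Anc G a b → List (Fin n)
  later anc-refl = []
  later (anc-step {c = c} _ p) = c ∷ later p

  anc⇒reach : ∀ {k a b} (p : Anc G a b) → length (later p) ≤ k → Reach k a b
  anc⇒reach {zero} anc-refl _ = refl
  anc⇒reach {suc k} anc-refl _ = inj₁ refl
  anc⇒reach {suc k} (anc-step d p) (s≤s ℓ) = inj₂ (_ , d , anc⇒reach p ℓ)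

  on-path : ∀ {a b w} (p : Anc G a b) → w ∈ₗ (a ∷ later p) → Anc G a w
  on-path p (here refl) = anc-refl
  on-path (anc-step d p) (there w∈) = anc-step d (on-path p w∈)

  path-unique : ∀ {a b} (p : Anc G a b) → Unique (a ∷ later p)
  path-unique anc-refl = [] ∷ []
  path-unique (anc-step d p) =
    All.tabulate (λ w∈ a≡w → acyclic _ _ d (subst (Anc G _) (sym a≡w) (on-path p w∈)))
    ∷ path-unique p

  -- a directed path has at most n vertices, hence at most n - 1 steps
  anc? : ∀ a b → Dec (Anc G a b)
  anc? a b = map′ (reach⇒anc n) (λ p → anc⇒reach p (short p)) (reach? n a b)
    where
      short : (p : Anc G a b) → length (later p) ≤ n
      short p = ≤-trans (n≤1+n _) (unique-length (path-unique p))

  an? : ∀ C w → Dec (AnOf G C w)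
  an? C w = any? (λ c → (c ∈? C) ×-dec anc? w c)

module AncestralFacts {n : ℕ} (G : DMG n) (acyclic : Acyclic G) (ancestral : Ancestral G) where
  open DMG G
  open GraphFacts G

  dir-distinct : ∀ {a b} → dir a b ≡ true → a ≢ b
  dir-distinct d refl = acyclic _ _ d anc-refl

  adj-distinct : ∀ {a b} → Adj G a b → a ≢ b
  adj-distinct (inj₁ d) = dir-distinct d
  adj-distinct (inj₂ (inj₁ d)) = dir-distinct d ∘ sym
  adj-distinct (inj₂ (inj₂ e)) refl = ancestral _ _ e anc-refl

  no-arrow-back : ∀ {a b} → dir a b ≡ true → ¬ Arr G b a
  no-arrow-back d (inj₁ d') = acyclic _ _ d (anc-edge d')
  no-arrow-back d (inj₂ e) = ancestral _ _ (bi-flip e) (anc-edge d)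

  no-ancestor-behind : ∀ {a c d} → Arr G a c → dir c d ≡ true → ¬ Anc G d a
  no-ancestor-behind (inj₁ a→c) c→d d⇝a = acyclic _ _ a→c (anc-step c→d d⇝a)
  no-ancestor-behind (inj₂ a↔c) c→d d⇝a = ancestral _ _ (bi-flip a↔c) (anc-step c→d d⇝a)

  bidirected : ∀ {a b} → Arr G a b → Arr G b a → bi a b ≡ true
  bidirected (inj₁ d) back = ⊥-elim (no-arrow-back d back)
  bidirected (inj₂ e) _ = e

-- A
-- route from x is a path x ∷ rest ending in v whose inner vertices are all open given
-- C; routes are grown at the front, shortcutting whenever the new vertex is already
-- on the route.
module MConnection {n : ℕ} (G : DMG n) (acyclic : Acyclic G) (ancestral : Ancestral G)
                   (C : Subset n) (v : Fin n) where
  open DMG G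
  open GraphFacts G
  open AncestralFacts G acyclic ancestral
  open Ancestry G acyclic
  open DecMembership (_≟_ {n}) using () renaming (_∈?_ to _∈ₗ?_)

  record Route (Q : Fin n × Fin n → Set) (x : Fin n) : Set where
    constructor route
    field
      rest    : List (Fin n)
      ends    : EndsAt v (x ∷ rest)
      is-path : IsPath G (x ∷ rest)
      is-open : All (MOk G C) (triples (x ∷ rest))
      edge-ok : All Q (pairs (x ∷ rest))
  open Route

  -- what must hold for y to be put in front of x ∷ t: x is open between y and t's head
  OpenAfter : Fin n → List (Fin n) → Set
  OpenAfter y (x ∷ z ∷ _) = MOk G C (y , x , z)
  OpenAfter _ _ = ⊤

  open-after : ∀ {y x} t → OpenAfter y (x ∷ t) →
               All (MOk G C) (triples (x ∷ t)) → All (MOk G C) (triples (y ∷ x ∷ t))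
  open-after [] _ _ = []
  open-after (_ ∷ _) fits opn = fits ∷ opn

  prepend : ∀ {Q x} y → Adj G y x → (ρ : Route Q x) → OpenAfter y (x ∷ rest ρ) → Q (y , x) → Route Q y
  prepend {x = x} y y~x (route t ends (uniq , adj) opn ok) fits q with y ∈ₗ? (x ∷ t)
  ... | yes y∈ = let (t' , s) = suffix-at y∈ in
    route t' (suffix-ends s ends) (suffix-unique s uniq , suffix-pairs s adj)
             (suffix-triples s opn) (suffix-pairs s ok)
  ... | no y∉ = route (x ∷ t) (cons ends) (¬Any⇒All¬ (x ∷ t) y∉ ∷ uniq , y~x ∷ adj)
                      (open-after t fits opn) (q ∷ ok)

  trivial : ∀ {Q} → Route Q v
  trivial = route [] end ([] ∷ [] , []) [] []

  forget : ∀ {Q x} → Route Q x → Route (λ _ → ⊤) x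
  forget (route t ends p opn ok) = route t ends p opn (All.map (λ _ → tt) ok)

  route-connects : ∀ {Q x} → x ≢ v → Route Q x → MConnected G C x v
  route-connects {x = x} x≢v (route t ends p opn _) with ends-split-tail x≢v ends
  ... | ms , refl = ms , p , opn

  noncollider-open : ∀ {y x z} → ¬ Collider G y x z → x ∉ C → MOk G C (y , x , z)
  noncollider-open nc x∉C = (λ col → ⊥-elim (nc col)) , (λ _ → x∉C)

  collider-open : ∀ {y x z} → Collider G y x z → AnOf G C x → MOk G C (y , x , z)
  collider-open col x∈anC = (λ _ → x∈anC) , (λ nc → ⊥-elim (nc col))

  -- an edge p – q along which a route may pass towards v: either p → q with p ∉ C,
  -- or p ↔ q with p ∈ an(C); entering p with an arrowhead then keeps p open
  Toward : Fin n × Fin n → Set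
  Toward (p , q) = (dir p q ≡ true × p ∉ C) ⊎ (bi p q ≡ true × AnOf G C p)

  entry-open : ∀ {y x} → Arr G y x → (ρ : Route Toward x) → OpenAfter y (x ∷ rest ρ)
  entry-open _ (route [] _ _ _ _) = tt
  entry-open _ (route (_ ∷ _) _ _ _ (inj₁ (d , x∉C) ∷ _)) =
    noncollider-open (λ col → no-arrow-back d (proj₂ col)) x∉C
  entry-open y*→x (route (_ ∷ _) _ _ _ (inj₂ (e , x∈anC) ∷ _)) =
    collider-open (y*→x , inj₂ (bi-flip e)) x∈anC

  -- leaving x along x → y makes x a noncollider
  exit-open : ∀ {x y} → dir x y ≡ true → x ∉ C → ∀ t → OpenAfter y (x ∷ t)
  exit-open _ _ [] = tt
  exit-open d x∉C (_ ∷ _) = noncollider-open (λ col → no-arrow-back d (proj₁ col)) x∉C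

  outside-an-child : ∀ {a c} → dir a c ≡ true → ¬ AnOf G C a → ¬ AnOf G C c
  outside-an-child d a∉ (k , k∈ , c⇝k) = a∉ (k , k∈ , anc-step d c⇝k)

  outside-an : ∀ {a} → ¬ AnOf G C a → a ∉ C
  outside-an a∉ a∈ = a∉ (_ , a∈ , anc-refl)

  descend : ∀ {a} → Anc G a v → ¬ AnOf G C a → Route Toward a
  descend anc-refl _ = trivial
  descend {a} (anc-step d p) a∉ =
    let ρ = descend p (outside-an-child d a∉) in
    prepend a (inj₁ d) ρ (entry-open (inj₁ d) ρ) (inj₁ (d , outside-an a∉))

  climb : ∀ {a u} → Anc G a u → ¬ AnOf G C a → Route (λ _ → ⊤) a → Route (λ _ → ⊤) u
  climb anc-refl _ ρ = ρ
  climb (anc-step {c = c} d p) a∉ ρ =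
    climb p (outside-an-child d a∉) (prepend c (inj₂ (inj₁ d)) ρ (exit-open d (outside-an a∉) (rest ρ)) tt)

  module _ (u : Fin n) (W : Fin n → Set) (W-anc : ∀ {w} → W w → Anc G w u ⊎ Anc G w v) where

    -- walking a bidirected path a ↔ … ↔ v backwards yields a route to v from a, or
    -- (once a vertex outside an(C) above u is met) a finished route from u
    walk-back : ∀ {a} → BiConn G W a v → Route (λ _ → ⊤) u ⊎ Route Toward a
    walk-back (bc-refl _) = inj₂ trivial
    walk-back (bc-step {u = a} Wa e path) with walk-back path
    ... | inj₁ done = inj₁ done
    ... | inj₂ ρ with an? C a | W-anc Wa
    ...   | yes a∈anC | _ = inj₂ (prepend a (inj₂ (inj₂ e)) ρ (entry-open (inj₂ e) ρ) (inj₂ (e , a∈anC)))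
    ...   | no a∉anC | inj₁ a⇝u =
            inj₁ (climb a⇝u a∉anC (prepend a (inj₂ (inj₂ e)) (forget ρ) (entry-open (inj₂ e) ρ) tt))
    ...   | no a∉anC | inj₂ a⇝v = inj₂ (descend a⇝v a∉anC)

    bidirected-m-connects : u ≢ v → BiConn G W u v → MConnected G C u v
    bidirected-m-connects u≢v path = [ route-connects u≢v , route-connects u≢v ] (walk-back path)

module FiniteSets {n : ℕ} where

  _⊆ˡ_ : Subset n → List (Fin n) → Set
  X ⊆ˡ xs = ∀ {z} → z ∈ X → z ∈ₗ xs

  ∅-⊆ˡ : ∅ ⊆ˡ []
  ∅-⊆ˡ z∈ = ⊥-elim (∉⊥ z∈)

  ⁅⁆-⊆ˡ : ∀ a → ⁅ a ⁆ ⊆ˡ (a ∷ [])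
  ⁅⁆-⊆ˡ a z∈ = here (x∈⁅y⁆⇒x≡y a z∈)

  ∪-⊆ˡ : ∀ {X Y} xs {ys} → X ⊆ˡ xs → Y ⊆ˡ ys → (X ∪ Y) ⊆ˡ (xs ++ ys)
  ∪-⊆ˡ {X} {Y} xs X⊆ Y⊆ z∈ with x∈p∪q⁻ X Y z∈
  ... | inj₁ z∈X = ∈-++⁺ˡ (X⊆ z∈X)
  ... | inj₂ z∈Y = ∈-++⁺ʳ xs (Y⊆ z∈Y)

  pair-⊆ˡ : ∀ a b → (⁅ a ⁆ ∪ ⁅ b ⁆) ⊆ˡ (a ∷ b ∷ [])
  pair-⊆ˡ a b = ∪-⊆ˡ (a ∷ []) (⁅⁆-⊆ˡ a) (⁅⁆-⊆ˡ b)

  triple-⊆ˡ : ∀ a b c → (⁅ a ⁆ ∪ ⁅ b ⁆ ∪ ⁅ c ⁆) ⊆ˡ (a ∷ b ∷ c ∷ [])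
  triple-⊆ˡ a b c = ∪-⊆ˡ (a ∷ []) (⁅⁆-⊆ˡ a) (pair-⊆ˡ b c)

  ⊆ˡ-without : ∀ {X y} xs {ys} → X ⊆ˡ (xs ++ y ∷ ys) → y ∉ X → X ⊆ˡ (xs ++ ys)
  ⊆ˡ-without xs X⊆ y∉ {z} z∈ with ∈-++⁻ xs (X⊆ z∈)
  ... | inj₁ z∈xs = ∈-++⁺ˡ z∈xs
  ... | inj₂ (here refl) = ⊥-elim (y∉ z∈)
  ... | inj₂ (there z∈ys) = ∈-++⁺ʳ xs z∈ys

  not-in-pair : ∀ {w p q} → w ≢ p → w ≢ q → w ∉ (⁅ p ⁆ ∪ ⁅ q ⁆)
  not-in-pair {p = p} {q} w≢p w≢q w∈ with pair-⊆ˡ p q w∈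
  ... | here w≡p = w≢p w≡p
  ... | there (here w≡q) = w≢q w≡q

  ∈-left : ∀ {z} {X Y : Subset n} → z ∈ X → z ∈ X ∪ Y
  ∈-left z∈ = x∈p∪q⁺ (inj₁ z∈)

  ∈-right : ∀ {z} {X Y : Subset n} → z ∈ Y → z ∈ X ∪ Y
  ∈-right z∈ = x∈p∪q⁺ (inj₂ z∈)

  ∈-triple₁ : ∀ (a b c : Fin n) → a ∈ ⁅ a ⁆ ∪ ⁅ b ⁆ ∪ ⁅ c ⁆
  ∈-triple₁ a _ _ = ∈-left (x∈⁅x⁆ a)

  ∈-triple₂ : ∀ (a b c : Fin n) → b ∈ ⁅ a ⁆ ∪ ⁅ b ⁆ ∪ ⁅ c ⁆
  ∈-triple₂ _ b _ = ∈-right (∈-left (x∈⁅x⁆ b))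

  ∈-triple₃ : ∀ (a b c : Fin n) → c ∈ ⁅ a ⁆ ∪ ⁅ b ⁆ ∪ ⁅ c ⁆
  ∈-triple₃ _ _ c = ∈-right (∈-right (x∈⁅x⁆ c))

  ∪-reverse₃ : ∀ (a b c : Fin n) → ⁅ a ⁆ ∪ ⁅ b ⁆ ∪ ⁅ c ⁆ ≡ ⁅ c ⁆ ∪ ⁅ b ⁆ ∪ ⁅ a ⁆
  ∪-reverse₃ a b c = begin
    ⁅ a ⁆ ∪ (⁅ b ⁆ ∪ ⁅ c ⁆)  ≡⟨ ∪-comm ⁅ a ⁆ _ ⟩
    (⁅ b ⁆ ∪ ⁅ c ⁆) ∪ ⁅ a ⁆  ≡⟨ cong (_∪ ⁅ a ⁆) (∪-comm ⁅ b ⁆ ⁅ c ⁆) ⟩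
    (⁅ c ⁆ ∪ ⁅ b ⁆) ∪ ⁅ a ⁆  ≡⟨ ∪-assoc ⁅ c ⁆ ⁅ b ⁆ ⁅ a ⁆ ⟩
    ⁅ c ⁆ ∪ (⁅ b ⁆ ∪ ⁅ a ⁆)  ∎
    where open ≡-Reasoning

  ∪-swap : ∀ (X Y Z : Subset n) → X ∪ (Y ∪ Z) ≡ Y ∪ (X ∪ Z)
  ∪-swap X Y Z = begin
    X ∪ (Y ∪ Z)  ≡⟨ ∪-assoc X Y Z ⟨
    (X ∪ Y) ∪ Z  ≡⟨ cong (_∪ Z) (∪-comm X Y) ⟩
    (Y ∪ X) ∪ Z  ≡⟨ ∪-assoc Y X Z ⟩
    Y ∪ (X ∪ Z)  ∎
    where open ≡-Reasoning

open FiniteSets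

module HeadsAndTails {n : ℕ} (G : DMG n) where
  open DMG G
  open GraphFacts G

  in-an : ∀ {H h} → h ∈ H → InAn G H h
  in-an h∈ = _ , h∈ , anc-refl

  not-below : ∀ {H w h} → ¬ InAn G H w → h ∈ H → ¬ Anc G w h
  not-below w∉an h∈ w⇝h = w∉an (_ , h∈ , w⇝h)

  tail-in-an : ∀ {H w} → InTail G H w → InAn G H w
  tail-in-an (inj₁ ((_ , _ , path) , _)) = biconn-end path
  tail-in-an (inj₂ (_ , (_ , _ , path) , w→d)) with biconn-end path
  ... | h , h∈ , d⇝h = h , h∈ , anc-step w→d d⇝h

  parent-in-tail : ∀ {H h w} → h ∈ H → dir w h ≡ true → InTail G H w
  parent-in-tail h∈ w→h = inj₂ (_ , (_ , h∈ , bc-refl (in-an h∈)) , w→h)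

  Incomparable : Fin n → Fin n → Set
  Incomparable h w = ¬ Anc G h w × ¬ Anc G w h

  barren-antichain : ∀ {H xs} → H ⊆ˡ xs → AllPairs Incomparable xs → BarrenAll G H
  barren-antichain H⊆ inc h w h∈ w∈ h⇝w with allPairs-members inc (H⊆ h∈) (H⊆ w∈)
  ... | inj₁ h≡w = h≡w
  ... | inj₂ (inj₁ (¬h⇝w , _)) = ⊥-elim (¬h⇝w h⇝w)
  ... | inj₂ (inj₂ (_ , ¬h⇝w)) = ⊥-elim (¬h⇝w h⇝w)

  head-from-hub : ∀ {H xs} → H ⊆ˡ xs → AllPairs Incomparable xs →
                  ∀ hub → All (BiConn G (InAn G H) hub) xs → IsHead G H
  head-from-hub H⊆ inc hub links =
    barren-antichain H⊆ inc ,
    λ h h' h∈ h'∈ → biconn-trans (biconn-sym (All.lookup links (H⊆ h∈))) (All.lookup links (H⊆ h'∈))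

  singleton-head : ∀ a → IsHead G ⁅ a ⁆
  singleton-head a = head-from-hub (⁅⁆-⊆ˡ a) ([] ∷ []) a (bc-refl (in-an (x∈⁅x⁆ a)) ∷ [])

  pair-head : ∀ {p q} → Incomparable p q →
              BiConn G (InAn G (⁅ p ⁆ ∪ ⁅ q ⁆)) p q → IsHead G (⁅ p ⁆ ∪ ⁅ q ⁆)
  pair-head {p} {q} p≁q p↔q = head-from-hub (pair-⊆ˡ p q) ((p≁q ∷ []) ∷ [] ∷ []) p
    (bc-refl (in-an (∈-left (x∈⁅x⁆ p))) ∷ p↔q ∷ [])

  in-S : ∀ {H A X} ts → IsHead G H → A ⊆ˡ ts → All (InTail G H) ts → H ∪ A ≡ X → InS G X
  in-S {H} {A} _ head A⊆ tails eq = H , A , head , (λ _ w∈ → All.lookup tails (A⊆ w∈)) , eq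

  head-⊆ˡ : ∀ {H A X : Subset n} {xs} → H ∪ A ≡ X → X ⊆ˡ xs → H ⊆ˡ xs
  head-⊆ˡ refl X⊆ h∈ = X⊆ (∈-left h∈)

  head-or-tail : ∀ {H A X : Subset n} → (∀ w → w ∈ A → InTail G H w) → H ∪ A ≡ X →
                 ∀ {z} → z ∈ X → z ∈ H ⊎ InTail G H z
  head-or-tail {H} {A} tails refl z∈ with x∈p∪q⁻ H A z∈
  ... | inj₁ z∈H = inj₁ z∈H
  ... | inj₂ z∈A = inj₂ (tails _ z∈A)

  tail-outside-head : ∀ {H z} → z ∈ H ⊎ InTail G H z → z ∉ H → InTail G H z
  tail-outside-head (inj₁ z∈H) z∉H = ⊥-elim (z∉H z∈H)
  tail-outside-head (inj₂ t) _ = t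

  module _ (ancestral : Ancestral G) where

    siblings-incomparable : ∀ {p q} → bi p q ≡ true → Incomparable p q
    siblings-incomparable e = ancestral _ _ e , ancestral _ _ (bi-flip e)

    bidirected-pair-head : ∀ {p q} → bi p q ≡ true → IsHead G (⁅ p ⁆ ∪ ⁅ q ⁆)
    bidirected-pair-head {p} {q} e = pair-head (siblings-incomparable e)
      (biconn-edge (in-an (∈-left (x∈⁅x⁆ p))) (in-an (∈-right (x∈⁅x⁆ q))) e)

    -- the district of a single vertex h inside an(h) is {h}: a sibling of h that is
    -- also an ancestor of h would violate ancestrality
    lone-district : ∀ {H h w} → H ⊆ˡ (h ∷ []) → BiConn G (InAn G H) h w → w ≡ h
    lone-district _ (bc-refl _) = refl
    lone-district H⊆ (bc-step _ e path) with biconn-start path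
    ... | k , k∈ , w'⇝k with H⊆ k∈
    ... | here refl = ⊥-elim (ancestral _ _ (bi-flip e) w'⇝k)

    singleton-tail : ∀ {H h w} → H ⊆ˡ (h ∷ []) → InTail G H w → dir w h ≡ true
    singleton-tail H⊆ (inj₁ ((_ , h∈ , path) , w∉)) with H⊆ h∈
    ... | here refl with lone-district H⊆ path
    ... | refl = ⊥-elim (w∉ h∈)
    singleton-tail H⊆ (inj₂ (_ , (_ , h∈ , path) , w→d)) with H⊆ h∈
    ... | here refl with lone-district H⊆ path
    ... | refl = w→d

module MAGExclusion {n : ℕ} (G : DMG n) (acyclic : Acyclic G) (ancestral : Ancestral G)
                    (maximal : Maximal G) where
  open DMG G
  open GraphFacts G
  open AncestralFacts G acyclic ancestral
  open HeadsAndTails G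

  -- district lemma: u ≢ v joined by a bidirected path through ancestors of u or v are
  -- adjacent, since otherwise a separating set would be m-connected across
  district-adjacent : ∀ {W u v} → u ≢ v → (∀ {w} → W w → Anc G w u ⊎ Anc G w v) →
                      BiConn G W u v → Adj G u v
  district-adjacent {W} {u} {v} u≢v W-anc path with adj? u v
  ... | yes u~v = u~v
  ... | no ¬u~v with maximal u v u≢v ¬u~v
  ... | C , _ , _ , ¬connected =
    ⊥-elim (¬connected (MConnection.bidirected-m-connects G acyclic ancestral C v u W W-anc u≢v path))

  head-pair-adjacent : ∀ {H a c} → IsHead G H → H ⊆ˡ (a ∷ c ∷ []) → a ≢ c →
                       a ∈ H ⊎ InTail G H a → c ∈ H ⊎ InTail G H c → Adj G a c
  head-pair-adjacent {H} {a} {c} (_ , connected) H⊆ a≢c a-in c-in with a ∈? H | c ∈? H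
  ... | yes a∈ | yes c∈ = district-adjacent a≢c W-anc (connected a c a∈ c∈)
    where
      W-anc : ∀ {w} → InAn G H w → Anc G w a ⊎ Anc G w c
      W-anc (h , h∈ , w⇝h) with H⊆ h∈
      ... | here refl = inj₁ w⇝h
      ... | there (here refl) = inj₂ w⇝h
  ... | yes _ | no c∉ =
    inj₂ (inj₁ (singleton-tail ancestral (⊆ˡ-without (a ∷ []) H⊆ c∉) (tail-outside-head c-in c∉)))
  ... | no a∉ | yes _ =
    inj₁ (singleton-tail ancestral (⊆ˡ-without [] H⊆ a∉) (tail-outside-head a-in a∉))
  ... | no a∉ | no c∉ with tail-in-an (tail-outside-head a-in a∉)
  ... | h , h∈ , _ with H⊆ h∈
  ... | here refl = ⊥-elim (a∉ h∈)
  ... | there (here refl) = ⊥-elim (c∉ h∈)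

  out-edge-excludes : ∀ {a b c} → dir b c ≡ true → ¬ Adj G a c → a ≢ c →
                      ¬ InS G (⁅ a ⁆ ∪ ⁅ b ⁆ ∪ ⁅ c ⁆)
  out-edge-excludes {a} {b} {c} b→c ¬a~c a≢c (H , A , head@(barren , _) , tails , H∪A≡X) =
    excluded (b ∈? H)
    where
      H⊆ : H ⊆ˡ (a ∷ b ∷ c ∷ [])
      H⊆ = head-⊆ˡ H∪A≡X (triple-⊆ˡ a b c)

      member : ∀ {z} → z ∈ ⁅ a ⁆ ∪ ⁅ b ⁆ ∪ ⁅ c ⁆ → z ∈ H ⊎ InTail G H z
      member = head-or-tail tails H∪A≡X

      -- with b ∈ H and c ∉ H, c lies in tail(H) ⊆ an(H), so b → c ⇝ h ∈ H for h ∈ {a, b, c}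
      below-head : b ∈ H → c ∉ H → ∀ {h} → h ∈ H → Anc G c h → ⊥
      below-head b∈ c∉ {h} h∈ c⇝h with H⊆ h∈
      ... | here refl = ¬a~c (subst (λ z → Adj G z c) (barren b h b∈ h∈ (anc-step b→c c⇝h)) (inj₁ b→c))
      ... | there (here refl) = acyclic b c b→c c⇝h
      ... | there (there (here refl)) = c∉ h∈

      excluded : Dec (b ∈ H) → ⊥
      excluded (no b∉) = ¬a~c (head-pair-adjacent head (⊆ˡ-without (a ∷ []) H⊆ b∉) a≢c
                                 (member (∈-triple₁ a b c)) (member (∈-triple₃ a b c)))
      excluded (yes b∈) with c ∈? H
      ... | yes c∈ = dir-distinct b→c (barren b c b∈ c∈ (anc-edge b→c))
      ... | no c∉ with tail-in-an (tail-outside-head (member (∈-triple₃ a b c)) c∉)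
      ... | _ , h∈ , c⇝h = below-head b∈ c∉ h∈ c⇝h

module Proposition {n : ℕ} (G : DMG n) (acyclic : Acyclic G) (ancestral : Ancestral G)
                   (maximal : Maximal G) where
  open DMG G
  open GraphFacts G
  open AncestralFacts G acyclic ancestral
  open Ancestry G acyclic
  open HeadsAndTails G
  open MAGExclusion G acyclic ancestral maximal

  -- (i) ⇒ : an edge a → b, b → a or a ↔ b gives the head {b}, {a} or {a, b}
  adjacent⇒in-S : ∀ {a b} → Adj G a b → InS G (⁅ a ⁆ ∪ ⁅ b ⁆)
  adjacent⇒in-S {a} {b} (inj₁ a→b) =
    in-S (a ∷ []) (singleton-head b) (⁅⁆-⊆ˡ a) (parent-in-tail (x∈⁅x⁆ b) a→b ∷ []) (∪-comm ⁅ b ⁆ ⁅ a ⁆)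
  adjacent⇒in-S {a} {b} (inj₂ (inj₁ b→a)) =
    in-S (b ∷ []) (singleton-head a) (⁅⁆-⊆ˡ b) (parent-in-tail (x∈⁅x⁆ a) b→a ∷ []) refl
  adjacent⇒in-S (inj₂ (inj₂ a↔b)) =
    in-S [] (bidirected-pair-head ancestral a↔b) ∅-⊆ˡ [] (∪-identityʳ _)

  -- (i) ⇐ : the head lies inside {a, b}
  pair-in-S⇒adjacent : ∀ {a b} → a ≢ b → InS G (⁅ a ⁆ ∪ ⁅ b ⁆) → Adj G a b
  pair-in-S⇒adjacent {a} {b} a≢b (H , A , head , tails , H∪A≡X) =
    head-pair-adjacent head (head-⊆ˡ H∪A≡X (pair-⊆ˡ a b)) a≢b
      (head-or-tail tails H∪A≡X (∈-left (x∈⁅x⁆ a))) (head-or-tail tails H∪A≡X (∈-right (x∈⁅x⁆ b)))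

  -- (ii) ⇒ : a missing arrowhead at b is an out-edge b → a or b → c
  unshielded-in-S⇒collider : ∀ {a b c} → Unshielded G a b c →
                             InS G (⁅ a ⁆ ∪ ⁅ b ⁆ ∪ ⁅ c ⁆) → Collider G a b c
  unshielded-in-S⇒collider {a} {b} {c} (a~b , b~c , ¬a~c , a≢c) s with arr? a b | arr? c b
  ... | yes a*→b | yes c*→b = a*→b , c*→b
  ... | no ¬a*→b | _ = ⊥-elim (out-edge-excludes (dir-without-arrow a~b ¬a*→b)
                         (¬a~c ∘ adj-sym) (a≢c ∘ sym) (subst (InS G) (∪-reverse₃ a b c) s))
  ... | yes _ | no ¬c*→b = ⊥-elim (out-edge-excludes (dir-without-arrow (adj-sym b~c) ¬c*→b) ¬a~c a≢c s)

  -- (ii) ⇐ for a ↔ b ↔ c: the head is {b, c}, {a, b} or {a, b, c} according to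
  -- whether a ⇝ c, c ⇝ a, or neither
  bidirected-collider-in-S : ∀ {a b c} → bi a b ≡ true → bi c b ≡ true → a ≢ c →
                             InS G (⁅ a ⁆ ∪ ⁅ b ⁆ ∪ ⁅ c ⁆)
  bidirected-collider-in-S {a} {b} {c} a↔b c↔b a≢c with anc? a c | anc? c a
  ... | yes a⇝c | _ =
    in-S (a ∷ []) (bidirected-pair-head ancestral (bi-flip c↔b)) (⁅⁆-⊆ˡ a)
      (inj₁ ((b , b∈ , biconn-edge (in-an b∈) (c , ∈-right (x∈⁅x⁆ c) , a⇝c) (bi-flip a↔b)) ,
             not-in-pair (adj-distinct (inj₂ (inj₂ a↔b))) a≢c) ∷ [])
      (∪-comm (⁅ b ⁆ ∪ ⁅ c ⁆) ⁅ a ⁆)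
    where b∈ = ∈-left (x∈⁅x⁆ b)
  ... | no _ | yes c⇝a =
    in-S (c ∷ []) (bidirected-pair-head ancestral a↔b) (⁅⁆-⊆ˡ c)
      (inj₁ ((b , b∈ , biconn-edge (in-an b∈) (a , ∈-left (x∈⁅x⁆ a) , c⇝a) (bi-flip c↔b)) ,
             not-in-pair (a≢c ∘ sym) (adj-distinct (inj₂ (inj₂ c↔b)))) ∷ [])
      (∪-assoc ⁅ a ⁆ ⁅ b ⁆ ⁅ c ⁆)
    where b∈ = ∈-right (x∈⁅x⁆ b)
  ... | no ¬a⇝c | no ¬c⇝a =
    in-S [] head ∅-⊆ˡ [] (∪-identityʳ _)
    where
      Wa = in-an (∈-triple₁ a b c)
      Wb = in-an (∈-triple₂ a b c)
      Wc = in-an (∈-triple₃ a b c)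
      head : IsHead G (⁅ a ⁆ ∪ ⁅ b ⁆ ∪ ⁅ c ⁆)
      head = head-from-hub (triple-⊆ˡ a b c)
        ((siblings-incomparable ancestral a↔b ∷ (¬a⇝c , ¬c⇝a) ∷ []) ∷
         (siblings-incomparable ancestral (bi-flip c↔b) ∷ []) ∷ [] ∷ [])
        b
        (biconn-edge Wb Wa (bi-flip a↔b) ∷ bc-refl Wb ∷ biconn-edge Wb Wc (bi-flip c↔b) ∷ [])

  -- (ii) ⇐ : a directed edge into b puts its source into the tail of a head at b
  unshielded-collider⇒in-S : ∀ {a b c} → Unshielded G a b c → Collider G a b c → InS G (⁅ a ⁆ ∪ ⁅ b ⁆ ∪ ⁅ c ⁆)
  unshielded-collider⇒in-S {a} {b} {c} _ (inj₁ a→b , inj₁ c→b) =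
    in-S (a ∷ c ∷ []) (singleton-head b) (pair-⊆ˡ a c)
      (parent-in-tail (x∈⁅x⁆ b) a→b ∷ parent-in-tail (x∈⁅x⁆ b) c→b ∷ []) (∪-swap ⁅ b ⁆ ⁅ a ⁆ ⁅ c ⁆)
  unshielded-collider⇒in-S {a} {b} {c} _ (inj₂ a↔b , inj₁ c→b) =
    in-S (c ∷ []) (bidirected-pair-head ancestral a↔b) (⁅⁆-⊆ˡ c)
      (parent-in-tail (∈-right (x∈⁅x⁆ b)) c→b ∷ []) (∪-assoc ⁅ a ⁆ ⁅ b ⁆ ⁅ c ⁆)
  unshielded-collider⇒in-S {a} {b} {c} _ (inj₁ a→b , inj₂ c↔b) =
    in-S (a ∷ []) (bidirected-pair-head ancestral (bi-flip c↔b)) (⁅⁆-⊆ˡ a)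
      (parent-in-tail (∈-left (x∈⁅x⁆ b)) a→b ∷ []) (∪-comm (⁅ b ⁆ ∪ ⁅ c ⁆) ⁅ a ⁆)
  unshielded-collider⇒in-S (_ , _ , _ , a≢c) (inj₂ a↔b , inj₂ c↔b) = bidirected-collider-in-S a↔b c↔b a≢c

  -- (iii), for a discriminating path ⟨x, q₁, …, qₘ, b, y⟩ given by its edge conditions
  module DiscriminatingPath {x q₁ : Fin n} {qr : List (Fin n)} {b y : Fin n}
    (¬x~y : ¬ Adj G x y) (x*→q₁ : Arr G x q₁)
    (q-chain : All (λ { (u , w) → bi u w ≡ true }) (pairs (q₁ ∷ qr)))
    (q→y : All (λ q → dir q y ≡ true) (q₁ ∷ qr))
    (b*→qₘ : Arr G b (last' q₁ qr)) (b*→y : Arr G b y) where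

    qₘ : Fin n
    qₘ = last' q₁ qr

    q⇝y : ∀ {z} → z ∈ₗ (q₁ ∷ qr) → Anc G z y
    q⇝y z∈ = anc-edge (All.lookup q→y z∈)

    qₘ∈ : qₘ ∈ₗ (q₁ ∷ qr)
    qₘ∈ = last'-member q₁ qr

    -- x *→ q₁ → y
    ¬y⇝x : ¬ Anc G y x
    ¬y⇝x = no-ancestor-behind x*→q₁ (All.lookup q→y (here refl))

    x≢y : x ≢ y
    x≢y refl = ¬y⇝x anc-refl

    -- x = b would make x adjacent to y
    x≢b : x ≢ b
    x≢b refl = ¬x~y (arr⇒adj b*→y)

    b≢y : b ≢ y
    b≢y = adj-distinct (arr⇒adj b*→y)

    noncollider-out-edge : ¬ Collider G qₘ b y → dir b y ≡ true
    noncollider-out-edge nc = out-edge b*→y b*→qₘ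
      where
        out-edge : Arr G b y → Arr G b qₘ → dir b y ≡ true
        out-edge (inj₁ b→y) _ = b→y
        out-edge (inj₂ b↔y) (inj₁ b→qₘ) = ⊥-elim (ancestral _ _ b↔y (anc-step b→qₘ (q⇝y qₘ∈)))
        out-edge (inj₂ b↔y) (inj₂ b↔qₘ) = ⊥-elim (nc (inj₂ (bi-flip b↔qₘ) , inj₂ (bi-flip b↔y)))

    -- (iii) ⇒ : otherwise b → y, an out-edge towards y, which is not adjacent to x
    discriminating-in-S⇒collider : InS G (⁅ x ⁆ ∪ ⁅ b ⁆ ∪ ⁅ y ⁆) → Collider G qₘ b y
    discriminating-in-S⇒collider s with arr? qₘ b ×-dec arr? y b
    ... | yes col = col
    ... | no nc = ⊥-elim (out-edge-excludes (noncollider-out-edge nc) ¬x~y x≢y s)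

    -- from here on b is a collider: qₘ ↔ b ↔ y
    module _ (qₘ*→b : Arr G qₘ b) (y*→b : Arr G y b) where

      b↔y : bi b y ≡ true
      b↔y = bidirected b*→y y*→b

      b-to-q₁ : ∀ {W} → W b → (∀ {z} → z ∈ₗ (q₁ ∷ qr) → W z) → BiConn G W b q₁
      b-to-q₁ Wb Wq = bc-step Wb (bi-flip (bidirected qₘ*→b b*→qₘ)) (biconn-sym (biconn-chain q₁ qr q-chain Wq))

      -- x → q₁ would make x an ancestor of y
      x↔q₁ : ¬ Anc G x y → bi x q₁ ≡ true
      x↔q₁ ¬x⇝y = sibling x*→q₁
        where
          sibling : Arr G x q₁ → bi x q₁ ≡ true
          sibling (inj₁ x→q₁) = ⊥-elim (¬x⇝y (anc-step x→q₁ (q⇝y (here refl))))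
          sibling (inj₂ x↔q₁') = x↔q₁'

      -- x ∈ an({b, y}): head {b, y}, with x in its tail
      ancestor-case : InAn G (⁅ b ⁆ ∪ ⁅ y ⁆) x → InS G (⁅ x ⁆ ∪ ⁅ b ⁆ ∪ ⁅ y ⁆)
      ancestor-case Wx = in-S (x ∷ []) (bidirected-pair-head ancestral b↔y) (⁅⁆-⊆ˡ x) (x-tail x*→q₁ ∷ [])
                              (∪-comm (⁅ b ⁆ ∪ ⁅ y ⁆) ⁅ x ⁆)
        where
          b∈ = ∈-left (x∈⁅x⁆ b)
          b-to-q₁-path = b-to-q₁ (in-an b∈) (λ z∈ → y , ∈-right (x∈⁅x⁆ y) , q⇝y z∈)
          x-tail : Arr G x q₁ → InTail G (⁅ b ⁆ ∪ ⁅ y ⁆) x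
          x-tail (inj₁ x→q₁) = inj₂ (q₁ , (b , b∈ , b-to-q₁-path) , x→q₁)
          x-tail (inj₂ x↔q₁') = inj₁ ((b , b∈ , biconn-snoc b-to-q₁-path (bi-flip x↔q₁') Wx) , not-in-pair x≢b x≢y)

      -- x ∉ an({b, y}) but b ⇝ x: head {x, y}, with b in its tail
      descendant-case : ¬ Anc G x y → Anc G b x → InS G (⁅ x ⁆ ∪ ⁅ b ⁆ ∪ ⁅ y ⁆)
      descendant-case ¬x⇝y b⇝x =
        in-S (b ∷ []) (pair-head (¬x⇝y , ¬y⇝x) x-to-y) (⁅⁆-⊆ˡ b)
             (inj₁ ((y , y∈ , biconn-edge Wy Wb (bi-flip b↔y)) , not-in-pair (x≢b ∘ sym) b≢y) ∷ [])
             (begin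
               (⁅ x ⁆ ∪ ⁅ y ⁆) ∪ ⁅ b ⁆  ≡⟨ ∪-assoc ⁅ x ⁆ ⁅ y ⁆ ⁅ b ⁆ ⟩
               ⁅ x ⁆ ∪ (⁅ y ⁆ ∪ ⁅ b ⁆)  ≡⟨ cong (⁅ x ⁆ ∪_) (∪-comm ⁅ y ⁆ ⁅ b ⁆) ⟩
               ⁅ x ⁆ ∪ (⁅ b ⁆ ∪ ⁅ y ⁆)  ∎)
        where
          open ≡-Reasoning
          x∈ = ∈-left (x∈⁅x⁆ x)
          y∈ = ∈-right (x∈⁅x⁆ y)
          Wy = in-an y∈
          Wb : InAn G (⁅ x ⁆ ∪ ⁅ y ⁆) b
          Wb = x , x∈ , b⇝x
          -- x ↔ q₁ ↔ … ↔ qₘ ↔ b ↔ y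
          x-to-y : BiConn G (InAn G (⁅ x ⁆ ∪ ⁅ y ⁆)) x y
          x-to-y = bc-step (in-an x∈) (x↔q₁ ¬x⇝y)
            (biconn-trans (biconn-sym (b-to-q₁ Wb (λ z∈ → y , y∈ , q⇝y z∈))) (biconn-edge Wb Wy b↔y))

      -- x, b, y pairwise incomparable: head {x, b, y} with hub b
      incomparable-case : ¬ Anc G x b → ¬ Anc G x y → ¬ Anc G b x → InS G (⁅ x ⁆ ∪ ⁅ b ⁆ ∪ ⁅ y ⁆)
      incomparable-case ¬x⇝b ¬x⇝y ¬b⇝x = in-S [] head ∅-⊆ˡ [] (∪-identityʳ _)
        where
          Wx = in-an (∈-triple₁ x b y)
          Wb = in-an (∈-triple₂ x b y)
          Wy = in-an (∈-triple₃ x b y)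
          head : IsHead G (⁅ x ⁆ ∪ ⁅ b ⁆ ∪ ⁅ y ⁆)
          head = head-from-hub (triple-⊆ˡ x b y)
            (((¬x⇝b , ¬b⇝x) ∷ (¬x⇝y , ¬y⇝x) ∷ []) ∷ (siblings-incomparable ancestral b↔y ∷ []) ∷ [] ∷ [])
            b
            (biconn-snoc (b-to-q₁ Wb (λ z∈ → y , ∈-triple₃ x b y , q⇝y z∈)) (bi-flip (x↔q₁ ¬x⇝y)) Wx
             ∷ bc-refl Wb ∷ biconn-edge Wb Wy b↔y ∷ [])

      discriminating-collider⇒in-S : InS G (⁅ x ⁆ ∪ ⁅ b ⁆ ∪ ⁅ y ⁆)
      discriminating-collider⇒in-S with an? (⁅ b ⁆ ∪ ⁅ y ⁆) x | anc? b x
      ... | yes x∈an | _ = ancestor-case x∈an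
      ... | no x∉an | yes b⇝x = descendant-case (not-below x∉an (∈-right (x∈⁅x⁆ y))) b⇝x
      ... | no x∉an | no ¬b⇝x =
        incomparable-case (not-below x∉an (∈-left (x∈⁅x⁆ b))) (not-below x∉an (∈-right (x∈⁅x⁆ y))) ¬b⇝x

proposition3p4 : ∀ {n : ℕ} (G : DMG n) → IsMAG G →
    (∀ (a b : Fin n) → a ≢ b → (Adj G a b ⇔ InS G (⁅ a ⁆ ∪ ⁅ b ⁆)))
    × (∀ (a b c : Fin n) → Unshielded G a b c →
        (InS G (⁅ a ⁆ ∪ ⁅ b ⁆ ∪ ⁅ c ⁆) ⇔ Collider G a b c))
    × (∀ (x q₁ : Fin n) (qr : List (Fin n)) (b y : Fin n) →
        Discriminating G x q₁ qr b y →
        (InS G (⁅ x ⁆ ∪ ⁅ b ⁆ ∪ ⁅ y ⁆) ⇔ Collider G (last' q₁ qr) b y))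
proposition3p4 G (acyclic , ancestral , maximal) =
    (λ _ _ a≢b → mk⇔ adjacent⇒in-S (pair-in-S⇒adjacent a≢b))
  , (λ _ _ _ u → mk⇔ (unshielded-in-S⇒collider u) (unshielded-collider⇒in-S u))
  , λ _ _ _ _ _ (_ , ¬x~y , x*→q₁ , q-chain , q→y , b*→qₘ , b*→y) →
      let open DiscriminatingPath ¬x~y x*→q₁ q-chain q→y b*→qₘ b*→y
      in mk⇔ discriminating-in-S⇒collider (λ (qₘ*→b , y*→b) → discriminating-collider⇒in-S qₘ*→b y*→b)
  where open Proposition G acyclic ancestral maximal
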